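{- Let $w\ge 6$, $h=\lfloor w/2\rfloor$, and $2\le s\le h-1$. Let $m,n\in A_w$ with $p(m)=(\alpha^1,\dots,\alpha^h)$, all $\alpha^i\ge1$, $\alpha^{s-1}+\alpha^s\ge 9$, $\alpha^s+\alpha^{s+1}\le 9$, and $p(n)=(\alpha^1,\dots,\alpha^{s-1},9-\alpha^s,\alpha^{s+1},\dots,\alpha^h)$. Then $K^2(m)=K^2(n)$.
   Context: A $w$-digit number is a string of $w$ decimal digits (leading zeros allowed); $A_w$ is the set of those whose digits are not all identical. For a $w$-digit number $n$, $O_d(n)=x_1\dots x_w$ is obtained by sorting its digits in non-increasing order and $O_u(n)=x_w\dots x_1$ by sorting them in non-decreasing order; the Kaprekar map is $K(n)=O_d(n)-O_u(n)$, written as a $w$-digit string with leading zeros, and $K^2=K\circ K$. The parameters of a $w$-digit number $n$ are $p(n)=(\alpha^1,\dots,\alpha^h)$, $\alpha^i=x_i-x_{w-i+1}$ where $x_1\ge\dots\ge x_w$ are its sorted digits. -}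

module Defs where

open import Data.Nat using (ℕ; zero; suc; _+_; _*_; _∸_; _^_; _≤ᵇ_; _/_; _%_)
open import Data.Fin using (Fin; toℕ; fromℕ<)
open import Data.Vec using (Vec; []; _∷_; _∷ʳ_; lookup; toList)
open import Data.List using (List; []; _∷_; foldl)
open import Data.Bool using (if_then_else_)
open import Data.Nat.DivMod using (m%n<n)
open import Data.Product using (∃₂)
open import Relation.Binary.PropositionalEquality using (_≢_)

-- A w-digit number: a string of w decimal digits (most significant first,
-- leading zeros allowed).
Digits : ℕ → Set
Digits w = Vec (Fin 10) w

InA : ∀ {w} → Digits w → Set
InA {w} n = ∃₂ λ (i j : Fin w) → lookup n i ≢ lookup n j

insert : ℕ → List ℕ → List ℕ
insert x [] = x ∷ []
insert x (y ∷ ys) = if x ≤ᵇ y then x ∷ y ∷ ys else y ∷ insert x ys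

sortAsc : List ℕ → List ℕ
sortAsc [] = []
sortAsc (x ∷ xs) = insert x (sortAsc xs)

reverseL : List ℕ → List ℕ
reverseL = foldl (λ acc x → x ∷ acc) []

digitList : ∀ {w} → Digits w → List ℕ
digitList n = Data.List.map toℕ (toList n)
  where import Data.List

ascDigits : ∀ {w} → Digits w → List ℕ
ascDigits n = sortAsc (digitList n)

descDigits : ∀ {w} → Digits w → List ℕ
descDigits n = reverseL (ascDigits n)

value : List ℕ → ℕ
value = foldl (λ acc d → 10 * acc + d) 0

Od Ou : ∀ {w} → Digits w → ℕ
Od n = value (descDigits n)
Ou n = value (ascDigits n)

-- the w-digit string of (x mod 10^w), with leading zeros
toDigits : (w : ℕ) → ℕ → Digits w
toDigits zero x = []
toDigits (suc w) x = toDigits w (x / 10) ∷ʳ fromℕ< (m%n<n x 10)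

-- Kaprekar map (O_d(n) - O_u(n) < 10^w, so no truncation occurs)
K : ∀ {w} → Digits w → Digits w
K {w} n = toDigits w (Od n ∸ Ou n)

K² : ∀ {w} → Digits w → Digits w
K² n = K (K n)

-- 0-based lookup in a list with default 0
at : List ℕ → ℕ → ℕ
at [] _ = 0
at (x ∷ xs) zero = x
at (x ∷ xs) (suc i) = at xs i

-- α^i(n) = x_i - x_{w-i+1}  (1-based i, x_1 ≥ … ≥ x_w the sorted digits)
α : ∀ {w} → Digits w → ℕ → ℕ
α {w} n i = at (descDigits n) (i ∸ 1) ∸ at (descDigits n) (w ∸ i)

params : ∀ {w} → Digits w → Vec ℕ (w / 2)
params {w} n = Data.Vec.tabulate (λ (i : Fin (w / 2)) → α n (suc (toℕ i)))

-- When all parameters αⁱ are positive, the digits of K(m) are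
--   α¹ … αʰ⁻¹ (αʰ − 1) 9ᵏ (9 − αʰ) … (9 − α²) (10 − α¹),   k = w mod 2,
-- because O_d(m) − O_u(m) can be computed column by column from the differences x_i − x_{w−i+1}.
-- For 2 ≤ s ≤ h − 1 both αˢ and 9 − αˢ occur in this string, away from the two corrected ends, so
-- replacing αˢ by 9 − αˢ only permutes the digits of K(m); K depends only on the multiset of digits,
-- hence K²(m) = K²(n).
module Submission where

open import Defs
open import Data.Bool using (if_then_else_)
open import Data.Fin using (toℕ; fromℕ<)
open import Data.Fin.Properties using (toℕ-fromℕ<; toℕ<n)
open import Data.List
  using (List; []; _∷_; _++_; [_]; length; map; reverse; replicate; take; drop; zipWith; foldl)
open import Data.List.Properties
  using ( length-++; length-map; length-reverse; length-replicate; length-take; length-drop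
        ; map-++; foldl-++; ++-assoc; reverse-++; reverse-involutive; unfold-reverse; take++drop≡id )
open import Data.List.Relation.Binary.Permutation.Propositional
  using (_↭_; ↭-refl; ↭-sym; ↭-trans; ↭-prep; ↭-swap; ↭⇒↭ₛ; module PermutationReasoning)
open import Data.List.Relation.Binary.Permutation.Propositional.Properties
  using (shift; ++⁺; ++⁺ˡ; ↭-reverse; ↭-length; All-resp-↭)
open import Data.List.Relation.Binary.Pointwise
  using (Pointwise; []; _∷_; Pointwise-≡⇒≡; Pointwise-length)
import Data.List.Relation.Binary.Pointwise as Pointwise
open import Data.List.Relation.Unary.All using (All; []; _∷_; universal)
import Data.List.Relation.Unary.All.Properties as All
open import Data.List.Relation.Unary.Sorted.TotalOrder.Properties using (↗↭↗⇒≋)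
open import Data.Nat
  using (ℕ; zero; suc; _+_; _*_; _∸_; _^_; _≤_; _<_; _/_; _%_; _⊓_; _≤ᵇ_; z≤n; s≤s; s≤s⁻¹)
open import Data.Nat.DivMod
  using (m≡m%n+[m/n]*n; m%n<n; [m+kn]%n≡m%n; m<n⇒m%n≡m; m<n⇒m/n≡0; m*n/n≡m; +-distrib-/-∣ʳ)
open import Data.Nat.Divisibility using (divides)
open import Data.Nat.Properties
  using ( _≟_; ≤-decTotalOrder; ≤-totalOrder; ≤-refl; ≤-trans; ≤-<-trans; <⇒≤; <-irrefl; n≤1+n
        ; m≤m+n; m≤n+m; m≤n⇒m<n∨m≡n; m≤n⇒m⊓n≡m; suc-injective; +-comm; +-assoc; +-identityʳ
        ; *-identityʳ; +-monoʳ-≤; ^-distribˡ-+-*; +-∸-assoc; m+n∸m≡n; m+[n∸m]≡n; m∸n+n≡m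
        ; m∸[m∸n]≡n; m∸n≤m; n∸n≡0; m<n⇒0<n∸m; m∸n≢0⇒n<m )
open import Data.Nat.Solver using (module +-*-Solver)
open import Data.Sum using (inj₁; inj₂)
open import Data.Vec using (toList; _∷ʳ_)
open import Data.Vec.Properties using (toList-∷ʳ; length-toList)
open import Function using (_∘_)
open import Relation.Binary.PropositionalEquality
  using (_≡_; _≢_; refl; sym; trans; cong; cong₂; subst; subst₂; module ≡-Reasoning)
open import Relation.Nullary using (yes; no)

import Data.List.Sort.InsertionSort.Base ≤-decTotalOrder as Insertion
import Data.List.Sort.InsertionSort.Properties ≤-decTotalOrder as Insertionₚ
open +-*-Solver

-- Defs.insert is the library's insertion: does (x ≤? y) computes to x ≤ᵇ y.
insert≡Insertion-insert : ∀ x xs → insert x xs ≡ Insertion.insert x xs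
insert≡Insertion-insert x [] = refl
insert≡Insertion-insert x (y ∷ ys) =
  cong (if x ≤ᵇ y then x ∷ y ∷ ys else_) (cong (y ∷_) (insert≡Insertion-insert x ys))

sortAsc≡Insertion-sort : ∀ xs → sortAsc xs ≡ Insertion.sort xs
sortAsc≡Insertion-sort [] = refl
sortAsc≡Insertion-sort (x ∷ xs) =
  trans (cong (insert x) (sortAsc≡Insertion-sort xs)) (insert≡Insertion-insert x (Insertion.sort xs))

sortAsc-↭ : ∀ xs → sortAsc xs ↭ xs
sortAsc-↭ xs = subst (_↭ xs) (sym (sortAsc≡Insertion-sort xs)) (Insertionₚ.sort-↭ xs)

sortAsc-cong-↭ : ∀ {xs ys} → xs ↭ ys → sortAsc xs ≡ sortAsc ys
sortAsc-cong-↭ {xs} {ys} xs↭ys = begin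
    sortAsc xs
      ≡⟨ sortAsc≡Insertion-sort xs ⟩
    Insertion.sort xs
      ≡⟨ Pointwise-≡⇒≡ (↗↭↗⇒≋ ≤-totalOrder (Insertionₚ.sort-↗ xs) (Insertionₚ.sort-↗ ys) (↭⇒↭ₛ sorts↭)) ⟩
    Insertion.sort ys
      ≡⟨ sortAsc≡Insertion-sort ys ⟨
    sortAsc ys ∎
  where
    open ≡-Reasoning
    sorts↭ : Insertion.sort xs ↭ Insertion.sort ys
    sorts↭ = ↭-trans (Insertionₚ.sort-↭ xs) (↭-trans xs↭ys (↭-sym (Insertionₚ.sort-↭ ys)))

K-cong-↭ : ∀ {w} {m n : Digits w} → digitList m ↭ digitList n → K m ≡ K n
K-cong-↭ {w} m↭n = cong (λ ds → toDigits w (value (reverseL ds) ∸ value ds)) (sortAsc-cong-↭ m↭n)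

descDigits-↭ : ∀ {w} (m : Digits w) → descDigits m ↭ digitList m
descDigits-↭ m = ↭-trans (↭-reverse (ascDigits m)) (sortAsc-↭ (digitList m))

length-descDigits : ∀ {w} (m : Digits w) → length (descDigits m) ≡ w
length-descDigits m =
  trans (↭-length (descDigits-↭ m)) (trans (length-map toℕ (toList m)) (length-toList m))

descDigits-bounded : ∀ {w} (m : Digits w) → All (_< 10) (descDigits m)
descDigits-bounded m = All-resp-↭ (↭-sym (descDigits-↭ m)) (All.map⁺ (universal toℕ<n (toList m)))

at-++ˡ : ∀ xs ys j → j < length xs → at (xs ++ ys) j ≡ at xs j
at-++ˡ (x ∷ xs) ys zero _ = refl
at-++ˡ (x ∷ xs) ys (suc j) (s≤s j<) = at-++ˡ xs ys j j<

at-++ʳ : ∀ xs ys i → at (xs ++ ys) (length xs + i) ≡ at ys i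
at-++ʳ [] ys i = refl
at-++ʳ (x ∷ xs) ys i = at-++ʳ xs ys i

at-reverse : ∀ xs j → j < length xs → at (reverse xs) j ≡ at xs (length xs ∸ suc j)
at-reverse (x ∷ xs) j (s≤s j≤n) rewrite unfold-reverse x xs with m≤n⇒m<n∨m≡n j≤n
... | inj₁ j<n = begin
    at (reverse xs ++ [ x ]) j
      ≡⟨ at-++ˡ (reverse xs) [ x ] j (subst (j <_) (sym (length-reverse xs)) j<n) ⟩
    at (reverse xs) j
      ≡⟨ at-reverse xs j j<n ⟩
    at xs (length xs ∸ suc j)
      ≡⟨ cong (at (x ∷ xs)) (+-∸-assoc 1 j<n) ⟨
    at (x ∷ xs) (length xs ∸ j) ∎
  where open ≡-Reasoning
... | inj₂ refl = begin
    at (reverse xs ++ [ x ]) (length xs)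
      ≡⟨ cong (at (reverse xs ++ [ x ])) (trans (+-identityʳ _) (length-reverse xs)) ⟨
    at (reverse xs ++ [ x ]) (length (reverse xs) + 0)
      ≡⟨ at-++ʳ (reverse xs) [ x ] 0 ⟩
    x
      ≡⟨ cong (at (x ∷ xs)) (n∸n≡0 (length xs)) ⟨
    at (x ∷ xs) (length xs ∸ length xs) ∎
  where open ≡-Reasoning

at-zipWith-∸ : ∀ xs ys j → length xs ≡ length ys → at (zipWith _∸_ xs ys) j ≡ at xs j ∸ at ys j
at-zipWith-∸ [] [] j _ = refl
at-zipWith-∸ (x ∷ xs) (y ∷ ys) zero _ = refl
at-zipWith-∸ (x ∷ xs) (y ∷ ys) (suc j) |xs|≡|ys| = at-zipWith-∸ xs ys j (suc-injective |xs|≡|ys|)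

All-at : ∀ {P : ℕ → Set} xs → (∀ j → j < length xs → P (at xs j)) → All P xs
All-at [] _ = []
All-at (x ∷ xs) P-at = P-at 0 (s≤s z≤n) ∷ All-at xs (λ j j< → P-at (suc j) (s≤s j<))

All-at⁻ : ∀ {P : ℕ → Set} {xs} → All P xs → ∀ j → j < length xs → P (at xs j)
All-at⁻ (px ∷ _) zero _ = px
All-at⁻ (_ ∷ pxs) (suc j) (s≤s j<) = All-at⁻ pxs j j<

at-extensionality : ∀ xs ys → length xs ≡ length ys →
  (∀ j → j < length xs → at xs j ≡ at ys j) → xs ≡ ys
at-extensionality [] [] _ _ = refl
at-extensionality (x ∷ xs) (y ∷ ys) |xs|≡|ys| at≡ =
  cong₂ _∷_ (at≡ 0 (s≤s z≤n))
    (at-extensionality xs ys (suc-injective |xs|≡|ys|) (λ j j< → at≡ (suc j) (s≤s j<)))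

≡-replaceAt : ∀ xs ys p → length xs ≡ length ys → p < length xs →
  (∀ j → j < length xs → j ≢ p → at ys j ≡ at xs j) → ys ≡ take p xs ++ at ys p ∷ drop (suc p) xs
≡-replaceAt (x ∷ xs) (y ∷ ys) zero |xs|≡|ys| _ agree =
  cong (y ∷_) (at-extensionality ys xs (sym (suc-injective |xs|≡|ys|)) λ j j< →
    agree (suc j) (s≤s (subst (j <_) (suc-injective (sym |xs|≡|ys|)) j<)) λ ())
≡-replaceAt (x ∷ xs) (y ∷ ys) (suc p) |xs|≡|ys| (s≤s p<) agree =
  cong₂ _∷_ (agree 0 (s≤s z≤n) λ ())
    (≡-replaceAt xs ys p (suc-injective |xs|≡|ys|) p< λ j j< j≢p →
      agree (suc j) (s≤s j<) (j≢p ∘ suc-injective))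

foldl-value : ∀ acc ds → foldl (λ acc d → 10 * acc + d) acc ds ≡ acc * 10 ^ length ds + value ds
foldl-value acc [] = sym (trans (+-identityʳ _) (*-identityʳ acc))
foldl-value acc (d ∷ ds) = begin
    foldl _ (10 * acc + d) ds
      ≡⟨ foldl-value (10 * acc + d) ds ⟩
    (10 * acc + d) * 10 ^ length ds + value ds
      ≡⟨ solve 4 (λ a d p v → (con 10 :* a :+ d) :* p :+ v := a :* (con 10 :* p) :+ (d :* p :+ v))
           refl acc d (10 ^ length ds) (value ds) ⟩
    acc * 10 ^ length (d ∷ ds) + (d * 10 ^ length ds + value ds)
      ≡⟨ cong (acc * 10 ^ length (d ∷ ds) +_) (foldl-value d ds) ⟨
    acc * 10 ^ length (d ∷ ds) + value (d ∷ ds) ∎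
  where open ≡-Reasoning

value-++ : ∀ xs ys → value (xs ++ ys) ≡ value xs * 10 ^ length ys + value ys
value-++ xs ys = trans (foldl-++ (λ acc d → 10 * acc + d) 0 xs ys) (foldl-value (value xs) ys)

value-++₃ : ∀ xs ys zs → value (xs ++ ys ++ zs) ≡
  value xs * 10 ^ (length ys + length zs) + (value ys * 10 ^ length zs + value zs)
value-++₃ xs ys zs = begin
    value (xs ++ ys ++ zs)
      ≡⟨ value-++ xs (ys ++ zs) ⟩
    value xs * 10 ^ length (ys ++ zs) + value (ys ++ zs)
      ≡⟨ cong₂ (λ l v → value xs * 10 ^ l + v) (length-++ ys) (value-++ ys zs) ⟩
    value xs * 10 ^ (length ys + length zs) + (value ys * 10 ^ length zs + value zs) ∎
  where open ≡-Reasoning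

value-replicate-9 : ∀ k → value (replicate k 9) + 1 ≡ 10 ^ k
value-replicate-9 zero = refl
value-replicate-9 (suc k) = begin
    value (9 ∷ replicate k 9) + 1
      ≡⟨ cong (_+ 1) (foldl-value 9 (replicate k 9)) ⟩
    9 * 10 ^ length (replicate k 9) + value (replicate k 9) + 1
      ≡⟨ cong (λ l → 9 * 10 ^ l + value (replicate k 9) + 1) (length-replicate k) ⟩
    9 * 10 ^ k + value (replicate k 9) + 1
      ≡⟨ +-assoc (9 * 10 ^ k) _ 1 ⟩
    9 * 10 ^ k + (value (replicate k 9) + 1)
      ≡⟨ cong (9 * 10 ^ k +_) (value-replicate-9 k) ⟩
    9 * 10 ^ k + 10 ^ k
      ≡⟨ solve 1 (λ p → con 9 :* p :+ p := con 10 :* p) refl (10 ^ k) ⟩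
    10 * 10 ^ k ∎
  where open ≡-Reasoning

valueLE : List ℕ → ℕ
valueLE [] = 0
valueLE (d ∷ ds) = d + valueLE ds * 10

value-reverse : ∀ ds → value (reverse ds) ≡ valueLE ds
value-reverse [] = refl
value-reverse (d ∷ ds) = begin
    value (reverse (d ∷ ds))     ≡⟨ cong value (unfold-reverse d ds) ⟩
    value (reverse ds ++ [ d ])  ≡⟨ value-++ (reverse ds) [ d ] ⟩
    value (reverse ds) * 10 + d  ≡⟨ cong (λ v → v * 10 + d) (value-reverse ds) ⟩
    valueLE ds * 10 + d          ≡⟨ +-comm (valueLE ds * 10) d ⟩
    valueLE (d ∷ ds)             ∎
  where open ≡-Reasoning

digitList-toDigits-valueLE : ∀ ds → All (_< 10) ds →
  digitList (toDigits (length ds) (valueLE ds)) ≡ reverse ds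
digitList-toDigits-valueLE [] [] = refl
digitList-toDigits-valueLE (d ∷ ds) (d<10 ∷ ds<10) = begin
    digitList (toDigits (length ds) (n / 10) ∷ʳ fromℕ< (m%n<n n 10))
      ≡⟨ cong (map toℕ) (toList-∷ʳ _ (toDigits (length ds) (n / 10))) ⟩
    map toℕ (toList (toDigits (length ds) (n / 10)) ++ [ fromℕ< (m%n<n n 10) ])
      ≡⟨ map-++ toℕ (toList (toDigits (length ds) (n / 10))) _ ⟩
    digitList (toDigits (length ds) (n / 10)) ++ [ toℕ (fromℕ< (m%n<n n 10)) ]
      ≡⟨ cong₂ (λ q r → digitList (toDigits (length ds) q) ++ [ r ]) quotient (trans (toℕ-fromℕ< _) remainder) ⟩
    digitList (toDigits (length ds) (valueLE ds)) ++ [ d ]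
      ≡⟨ cong (_++ [ d ]) (digitList-toDigits-valueLE ds ds<10) ⟩
    reverse ds ++ [ d ]
      ≡⟨ unfold-reverse d ds ⟨
    reverse (d ∷ ds) ∎
  where
    open ≡-Reasoning
    n = d + valueLE ds * 10
    quotient : n / 10 ≡ valueLE ds
    quotient = begin
      n / 10                         ≡⟨ +-distrib-/-∣ʳ d (divides (valueLE ds) refl) ⟩
      d / 10 + valueLE ds * 10 / 10  ≡⟨ cong₂ _+_ (m<n⇒m/n≡0 d<10) (m*n/n≡m (valueLE ds) 10) ⟩
      valueLE ds                     ∎
    remainder : n % 10 ≡ d
    remainder = trans ([m+kn]%n≡m%n d (valueLE ds) 10) (m<n⇒m%n≡m d<10)

digitList-toDigits : ∀ ds → All (_< 10) ds → digitList (toDigits (length ds) (value ds)) ≡ ds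
digitList-toDigits ds ds<10 = begin
    digitList (toDigits (length ds) (value ds))
      ≡⟨ cong₂ (λ l v → digitList (toDigits l v)) (length-reverse ds) valueLE-reverse ⟨
    digitList (toDigits (length (reverse ds)) (valueLE (reverse ds)))
      ≡⟨ digitList-toDigits-valueLE (reverse ds) (All-resp-↭ (↭-sym (↭-reverse ds)) ds<10) ⟩
    reverse (reverse ds)
      ≡⟨ reverse-involutive ds ⟩
    ds ∎
  where
    open ≡-Reasoning
    valueLE-reverse : valueLE (reverse ds) ≡ value ds
    valueLE-reverse = trans (sym (value-reverse (reverse ds))) (cong value (reverse-involutive ds))

length-zipWith-∸ : ∀ xs ys → length xs ≡ length ys → length (zipWith _∸_ xs ys) ≡ length xs
length-zipWith-∸ [] [] _ = refl
length-zipWith-∸ (x ∷ xs) (y ∷ ys) |xs|≡|ys| = cong suc (length-zipWith-∸ xs ys (suc-injective |xs|≡|ys|))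

value-zipWith-∸ : ∀ {xs ys} → Pointwise _≤_ ys xs → value xs ≡ value ys + value (zipWith _∸_ xs ys)
value-zipWith-∸ [] = refl
value-zipWith-∸ {x ∷ xs} {y ∷ ys} (y≤x ∷ ys≤xs) = begin
    value (x ∷ xs)
      ≡⟨ foldl-value x xs ⟩
    x * 10 ^ length xs + value xs
      ≡⟨ cong₂ (λ a b → a * 10 ^ length xs + b) (m+[n∸m]≡n y≤x) (sym (value-zipWith-∸ ys≤xs)) ⟨
    (y + (x ∸ y)) * 10 ^ length xs + (value ys + value zs)
      ≡⟨ solve 5 (λ y z p v u → (y :+ z) :* p :+ (v :+ u) := (y :* p :+ v) :+ (z :* p :+ u))
           refl y (x ∸ y) (10 ^ length xs) (value ys) (value zs) ⟩
    (y * 10 ^ length xs + value ys) + ((x ∸ y) * 10 ^ length xs + value zs)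
      ≡⟨ cong₂ (λ l l′ → (y * 10 ^ l + value ys) + ((x ∸ y) * 10 ^ l′ + value zs)) |ys|≡|xs| |zs|≡|xs| ⟨
    (y * 10 ^ length ys + value ys) + ((x ∸ y) * 10 ^ length zs + value zs)
      ≡⟨ cong₂ _+_ (foldl-value y ys) (foldl-value (x ∸ y) zs) ⟨
    value (y ∷ ys) + value ((x ∸ y) ∷ zs) ∎
  where
    open ≡-Reasoning
    zs = zipWith _∸_ xs ys
    |ys|≡|xs| : length ys ≡ length xs
    |ys|≡|xs| = Pointwise-length ys≤xs
    |zs|≡|xs| : length zs ≡ length xs
    |zs|≡|xs| = length-zipWith-∸ xs ys (sym |ys|≡|xs|)

valueLE-zipWith-∸ : ∀ {xs ys} → Pointwise _≤_ ys xs → valueLE xs ≡ valueLE ys + valueLE (zipWith _∸_ xs ys)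
valueLE-zipWith-∸ [] = refl
valueLE-zipWith-∸ {x ∷ xs} {y ∷ ys} (y≤x ∷ ys≤xs) = begin
    x + valueLE xs * 10
      ≡⟨ cong₂ (λ a b → a + b * 10) (m+[n∸m]≡n y≤x) (sym (valueLE-zipWith-∸ ys≤xs)) ⟨
    (y + (x ∸ y)) + (valueLE ys + valueLE zs) * 10
      ≡⟨ solve 4 (λ y z v u → (y :+ z) :+ (v :+ u) :* con 10 := (y :+ v :* con 10) :+ (z :+ u :* con 10))
           refl y (x ∸ y) (valueLE ys) (valueLE zs) ⟩
    (y + valueLE ys * 10) + ((x ∸ y) + valueLE zs * 10) ∎
  where
    open ≡-Reasoning
    zs = zipWith _∸_ xs ys

zipWith-∸-bounded : ∀ {b} xs ys → All (_< b) xs → All (_< b) (zipWith _∸_ xs ys)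
zipWith-∸-bounded [] ys [] = []
zipWith-∸-bounded (x ∷ xs) [] _ = []
zipWith-∸-bounded (x ∷ xs) (y ∷ ys) (x<b ∷ xs<b) = ≤-<-trans (m∸n≤m x y) x<b ∷ zipWith-∸-bounded xs ys xs<b

positive-differences : ∀ {xs ys} → Pointwise _<_ ys xs → All (1 ≤_) (zipWith _∸_ xs ys)
positive-differences [] = []
positive-differences (y<x ∷ ys<xs) = m<n⇒0<n∸m y<x ∷ positive-differences ys<xs

positive-differences⁻¹ : ∀ xs ys → length xs ≡ length ys →
  All (1 ≤_) (zipWith _∸_ xs ys) → Pointwise _<_ ys xs
positive-differences⁻¹ [] [] _ _ = []
positive-differences⁻¹ (x ∷ xs) (y ∷ ys) |xs|≡|ys| (0<x∸y ∷ rest) =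
  m∸n≢0⇒n<m (λ x∸y≡0 → <-irrefl (sym x∸y≡0) 0<x∸y)
    ∷ positive-differences⁻¹ xs ys (suc-injective |xs|≡|ys|) rest

decLast : List ℕ → List ℕ
decLast [] = []
decLast (x ∷ []) = x ∸ 1 ∷ []
decLast (x ∷ y ∷ ys) = x ∷ decLast (y ∷ ys)

incHead : List ℕ → List ℕ
incHead [] = []
incHead (x ∷ xs) = suc x ∷ xs

complement : List ℕ → List ℕ
complement = map (9 ∸_)

kaprekarDigits : List ℕ → ℕ → List ℕ
kaprekarDigits a k = decLast a ++ replicate k 9 ++ reverse (incHead (complement a))

length-decLast : ∀ a → length (decLast a) ≡ length a
length-decLast [] = refl
length-decLast (x ∷ []) = refl
length-decLast (x ∷ y ∷ ys) = cong suc (length-decLast (y ∷ ys))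

length-incHead : ∀ a → length (incHead a) ≡ length a
length-incHead [] = refl
length-incHead (x ∷ xs) = refl

length-kaprekarDigits : ∀ a k → length (kaprekarDigits a k) ≡ length a + (k + length a)
length-kaprekarDigits a k = begin
    length (decLast a ++ replicate k 9 ++ tail)
      ≡⟨ trans (length-++ (decLast a)) (cong (length (decLast a) +_) (length-++ (replicate k 9))) ⟩
    length (decLast a) + (length (replicate k 9) + length tail)
      ≡⟨ cong₂ (λ l l′ → l + (l′ + length tail)) (length-decLast a) (length-replicate k) ⟩
    length a + (k + length tail)
      ≡⟨ cong (λ l → length a + (k + l)) |tail| ⟩
    length a + (k + length a) ∎
  where
    open ≡-Reasoning
    tail = reverse (incHead (complement a))
    |tail| : length tail ≡ length a
    |tail| = trans (length-reverse (incHead (complement a)))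
                   (trans (length-incHead (complement a)) (length-map (9 ∸_) a))

decLast-bounded : ∀ {a} → All (_< 10) a → All (_< 10) (decLast a)
decLast-bounded [] = []
decLast-bounded (x<10 ∷ []) = ≤-<-trans (m∸n≤m _ 1) x<10 ∷ []
decLast-bounded (x<10 ∷ y<10 ∷ ys<10) = x<10 ∷ decLast-bounded (y<10 ∷ ys<10)

complement-bounded : ∀ a → All (_< 10) (complement a)
complement-bounded a = All.map⁺ (universal (λ x → s≤s (m∸n≤m 9 x)) a)

incHead-complement-bounded : ∀ {a} → All (1 ≤_) a → All (_< 10) (incHead (complement a))
incHead-complement-bounded [] = []
incHead-complement-bounded {suc x ∷ xs} (_ ∷ _) = s≤s (s≤s (m∸n≤m 8 x)) ∷ complement-bounded xs

kaprekarDigits-bounded : ∀ {a} k → All (1 ≤_) a → All (_< 10) a → All (_< 10) (kaprekarDigits a k)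
kaprekarDigits-bounded k a≥1 a<10 =
  All.++⁺ (decLast-bounded a<10) (All.++⁺ (All.replicate⁺ k ≤-refl)
    (All-resp-↭ (↭-sym (↭-reverse _)) (incHead-complement-bounded a≥1)))

value-decLast : ∀ x xs → All (1 ≤_) (x ∷ xs) → value (decLast (x ∷ xs)) + 1 ≡ value (x ∷ xs)
value-decLast x [] (x≥1 ∷ []) = m∸n+n≡m x≥1
value-decLast x (y ∷ ys) (_ ∷ y∷ys≥1) = begin
    value (x ∷ decLast (y ∷ ys)) + 1
      ≡⟨ cong (_+ 1) (foldl-value x (decLast (y ∷ ys))) ⟩
    x * 10 ^ length (decLast (y ∷ ys)) + value (decLast (y ∷ ys)) + 1
      ≡⟨ +-assoc (x * 10 ^ length (decLast (y ∷ ys))) _ 1 ⟩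
    x * 10 ^ length (decLast (y ∷ ys)) + (value (decLast (y ∷ ys)) + 1)
      ≡⟨ cong₂ (λ l v → x * 10 ^ l + v) (length-decLast (y ∷ ys)) (value-decLast y ys y∷ys≥1) ⟩
    x * 10 ^ length (y ∷ ys) + value (y ∷ ys)
      ≡⟨ foldl-value x (y ∷ ys) ⟨
    value (x ∷ y ∷ ys) ∎
  where open ≡-Reasoning

valueLE-complement : ∀ {a} → All (_< 10) a → valueLE (complement a) + valueLE a + 1 ≡ 10 ^ length a
valueLE-complement [] = refl
valueLE-complement {x ∷ xs} (x<10 ∷ xs<10) = begin
    (9 ∸ x) + c * 10 + (x + r * 10) + 1
      ≡⟨ solve 4 (λ y x c r → y :+ c :* con 10 :+ (x :+ r :* con 10) :+ con 1
                            := (y :+ x) :+ con 1 :+ (c :+ r) :* con 10) refl (9 ∸ x) x c r ⟩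
    (9 ∸ x) + x + 1 + (c + r) * 10
      ≡⟨ cong (λ n → n + 1 + (c + r) * 10) (m∸n+n≡m (s≤s⁻¹ x<10)) ⟩
    10 + (c + r) * 10
      ≡⟨ solve 1 (λ n → con 10 :+ n :* con 10 := con 10 :* (n :+ con 1)) refl (c + r) ⟩
    10 * (c + r + 1)
      ≡⟨ cong (10 *_) (valueLE-complement xs<10) ⟩
    10 * 10 ^ length xs ∎
  where
    open ≡-Reasoning
    c = valueLE (complement xs)
    r = valueLE xs

value-kaprekarDigits : ∀ a k → 1 ≤ length a → All (1 ≤_) a → All (_< 10) a →
  value (kaprekarDigits a k) + valueLE a ≡ value a * 10 ^ (k + length a)
value-kaprekarDigits a@(x ∷ xs) k _ a≥1 a<10 = begin
    value (decLast a ++ replicate k 9 ++ tail) + r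
      ≡⟨ cong (_+ r) (value-++₃ (decLast a) (replicate k 9) tail) ⟩
    d * 10 ^ (length (replicate k 9) + length tail) + (n9 * 10 ^ length tail + value tail) + r
      ≡⟨ cong₂ (λ l v → d * 10 ^ (length (replicate k 9) + l) + (n9 * 10 ^ l + v) + r)
           |tail| (value-reverse (incHead (complement a))) ⟩
    d * 10 ^ (length (replicate k 9) + length a) + (n9 * N + suc c) + r
      ≡⟨ cong (λ l → d * 10 ^ (l + length a) + (n9 * N + suc c) + r) (length-replicate k) ⟩
    d * P + (n9 * N + suc c) + r
      ≡⟨ solve 6 (λ d P n9 N c r → d :* P :+ (n9 :* N :+ (con 1 :+ c)) :+ r
                                 := d :* P :+ (n9 :* N :+ (c :+ r :+ con 1))) refl d P n9 N c r ⟩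
    d * P + (n9 * N + (c + r + 1))
      ≡⟨ cong (λ n → d * P + (n9 * N + n)) (valueLE-complement a<10) ⟩
    d * P + (n9 * N + N)
      ≡⟨ solve 4 (λ d P n9 N → d :* P :+ (n9 :* N :+ N) := d :* P :+ (n9 :+ con 1) :* N) refl d P n9 N ⟩
    d * P + (n9 + 1) * N
      ≡⟨ cong (λ n → d * P + n * N) (value-replicate-9 k) ⟩
    d * P + 10 ^ k * N
      ≡⟨ cong (d * P +_) (^-distribˡ-+-* 10 k (length a)) ⟨
    d * P + P
      ≡⟨ solve 2 (λ d P → d :* P :+ P := (d :+ con 1) :* P) refl d P ⟩
    (d + 1) * P
      ≡⟨ cong (_* P) (value-decLast x xs a≥1) ⟩
    value a * P ∎
  where
    open ≡-Reasoning
    tail = reverse (incHead (complement a))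
    d = value (decLast a)
    n9 = value (replicate k 9)
    c = valueLE (complement a)
    r = valueLE a
    N = 10 ^ length a
    P = 10 ^ (k + length a)
    |tail| : length tail ≡ length a
    |tail| = trans (length-reverse (incHead (complement a))) (cong suc (length-map (9 ∸_) xs))

reverse-++-palindrome : ∀ {A : Set} (xs ys zs : List A) → reverse ys ≡ ys →
  reverse (xs ++ ys ++ zs) ≡ reverse zs ++ ys ++ reverse xs
reverse-++-palindrome xs ys zs ys-palindrome = begin
    reverse (xs ++ ys ++ zs)                  ≡⟨ reverse-++ xs (ys ++ zs) ⟩
    reverse (ys ++ zs) ++ reverse xs          ≡⟨ cong (_++ reverse xs) (reverse-++ ys zs) ⟩
    (reverse zs ++ reverse ys) ++ reverse xs  ≡⟨ ++-assoc (reverse zs) (reverse ys) (reverse xs) ⟩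
    reverse zs ++ reverse ys ++ reverse xs    ≡⟨ cong (λ l → reverse zs ++ l ++ reverse xs) ys-palindrome ⟩
    reverse zs ++ ys ++ reverse xs            ∎
  where open ≡-Reasoning

reverse-short : ∀ {A : Set} (xs : List A) → length xs ≤ 1 → reverse xs ≡ xs
reverse-short [] _ = refl
reverse-short (x ∷ []) _ = refl
reverse-short (x ∷ y ∷ xs) (s≤s ())

-- Since reverse B lies digitwise below T, with a = T − reverse B digitwise the outer blocks differ
-- by value a · 10^(k+h) on the left and by valueLE a on the right; the palindromic middle cancels.
value≡value-reverse+kaprekarDigits : ∀ T M B → reverse M ≡ M → 1 ≤ length T →
  Pointwise _<_ (reverse B) T → All (_< 10) T →
  value (T ++ M ++ B) ≡
  value (reverse (T ++ M ++ B)) + value (kaprekarDigits (zipWith _∸_ T (reverse B)) (length M))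
value≡value-reverse+kaprekarDigits T M B M-palindrome 1≤|T| B′<T T<10 = begin
    value (T ++ M ++ B)
      ≡⟨ value-++₃ T M B ⟩
    value T * 10 ^ (k + length B) + (value M * 10 ^ length B + value B)
      ≡⟨ cong₂ (λ l v → value T * 10 ^ (k + l) + (value M * 10 ^ l + v)) |B|≡|T| value-B ⟩
    value T * P + (value M * N + valueLE B′)
      ≡⟨ cong (λ v → v * P + (value M * N + valueLE B′)) (value-zipWith-∸ B′≤T) ⟩
    (value B′ + value a) * P + (value M * N + valueLE B′)
      ≡⟨ solve 5 (λ b v P u e → (b :+ v) :* P :+ (u :+ e) := b :* P :+ (u :+ e) :+ v :* P)
           refl (value B′) (value a) P (value M * N) (valueLE B′) ⟩
    value B′ * P + (value M * N + valueLE B′) + value a * P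
      ≡⟨ cong (value B′ * P + (value M * N + valueLE B′) +_) value-kd ⟨
    value B′ * P + (value M * N + valueLE B′) + (value kd + valueLE a)
      ≡⟨ solve 5 (λ bP u e d r → bP :+ (u :+ e) :+ (d :+ r) := bP :+ (u :+ (e :+ r)) :+ d)
           refl (value B′ * P) (value M * N) (valueLE B′) (value kd) (valueLE a) ⟩
    value B′ * P + (value M * N + (valueLE B′ + valueLE a)) + value kd
      ≡⟨ cong (λ v → value B′ * P + (value M * N + v) + value kd) value-reverse-T ⟨
    value B′ * P + (value M * N + value (reverse T)) + value kd
      ≡⟨ cong (_+ value kd) value-reversed ⟨
    value (reverse (T ++ M ++ B)) + value kd ∎
  where
    open ≡-Reasoning
    B′ = reverse B
    a = zipWith _∸_ T B′
    k = length M
    kd = kaprekarDigits a k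
    N = 10 ^ length T
    P = 10 ^ (k + length T)
    B′≤T : Pointwise _≤_ B′ T
    B′≤T = Pointwise.map <⇒≤ B′<T
    |B|≡|T| : length B ≡ length T
    |B|≡|T| = trans (sym (length-reverse B)) (Pointwise-length B′<T)
    |a|≡|T| : length a ≡ length T
    |a|≡|T| = length-zipWith-∸ T B′ (sym (Pointwise-length B′<T))
    value-B : value B ≡ valueLE B′
    value-B = trans (cong value (sym (reverse-involutive B))) (value-reverse B′)
    value-reverse-T : value (reverse T) ≡ valueLE B′ + valueLE a
    value-reverse-T = trans (value-reverse T) (valueLE-zipWith-∸ B′≤T)
    value-kd : value kd + valueLE a ≡ value a * P
    value-kd = trans
      (value-kaprekarDigits a k (subst (1 ≤_) (sym |a|≡|T|) 1≤|T|) (positive-differences B′<T)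
        (zipWith-∸-bounded T B′ T<10))
      (cong (λ l → value a * 10 ^ (k + l)) |a|≡|T|)
    value-reversed : value (reverse (T ++ M ++ B)) ≡ value B′ * P + (value M * N + value (reverse T))
    value-reversed = begin
      value (reverse (T ++ M ++ B))
        ≡⟨ cong value (reverse-++-palindrome T M B M-palindrome) ⟩
      value (B′ ++ M ++ reverse T)
        ≡⟨ value-++₃ B′ M (reverse T) ⟩
      value B′ * 10 ^ (k + length (reverse T)) + (value M * 10 ^ length (reverse T) + value (reverse T))
        ≡⟨ cong (λ l → value B′ * 10 ^ (k + l) + (value M * 10 ^ l + value (reverse T))) (length-reverse T) ⟩
      value B′ * P + (value M * N + value (reverse T)) ∎

module Halves (h k : ℕ) (ds : List ℕ) (|ds| : length ds ≡ h + (k + h)) where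

  top middle bottom : List ℕ
  top = take h ds
  middle = take k (drop h ds)
  bottom = drop k (drop h ds)

  outerDifferences : List ℕ
  outerDifferences = zipWith _∸_ top (reverse bottom)

  split : ds ≡ top ++ middle ++ bottom
  split = trans (sym (take++drop≡id h ds)) (cong (top ++_) (sym (take++drop≡id k (drop h ds))))

  length-top : length top ≡ h
  length-top = trans (length-take h ds) (trans (cong (h ⊓_) |ds|) (m≤n⇒m⊓n≡m (m≤m+n h (k + h))))

  length-rest : length (drop h ds) ≡ k + h
  length-rest = trans (length-drop h ds) (trans (cong (_∸ h) |ds|) (m+n∸m≡n h (k + h)))

  length-middle : length middle ≡ k
  length-middle =
    trans (length-take k (drop h ds)) (trans (cong (k ⊓_) length-rest) (m≤n⇒m⊓n≡m (m≤m+n k h)))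

  length-bottom : length bottom ≡ h
  length-bottom = trans (length-drop k (drop h ds)) (trans (cong (_∸ k) length-rest) (m+n∸m≡n k h))

  |top|≡|reverse-bottom| : length top ≡ length (reverse bottom)
  |top|≡|reverse-bottom| = trans length-top (sym (trans (length-reverse bottom) length-bottom))

  length-outerDifferences : length outerDifferences ≡ h
  length-outerDifferences = trans (length-zipWith-∸ top (reverse bottom) |top|≡|reverse-bottom|) length-top

  at-outerDifferences : ∀ j → j < h → at outerDifferences j ≡ at ds j ∸ at ds (h + (k + h) ∸ suc j)
  at-outerDifferences j j<h = begin
      at outerDifferences j
        ≡⟨ at-zipWith-∸ top (reverse bottom) j |top|≡|reverse-bottom| ⟩
      at top j ∸ at (reverse bottom) j
        ≡⟨ cong (at top j ∸_) (at-reverse bottom j (subst (j <_) (sym length-bottom) j<h)) ⟩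
      at top j ∸ at bottom (length bottom ∸ suc j)
        ≡⟨ cong₂ _∸_ (at-++ˡ top (middle ++ bottom) j (subst (j <_) (sym length-top) j<h))
                     (trans (at-++ʳ top (middle ++ bottom) _) (at-++ʳ middle bottom _)) ⟨
      at (top ++ middle ++ bottom) j ∸ at (top ++ middle ++ bottom) (length top + (length middle + (length bottom ∸ suc j)))
        ≡⟨ cong₂ (λ l i → at l j ∸ at l i) (sym split) index ⟩
      at ds j ∸ at ds (h + (k + h) ∸ suc j) ∎
    where
      open ≡-Reasoning
      index : length top + (length middle + (length bottom ∸ suc j)) ≡ h + (k + h) ∸ suc j
      index = begin
        length top + (length middle + (length bottom ∸ suc j))
          ≡⟨ cong₂ (λ t l → t + (l + (length bottom ∸ suc j))) length-top length-middle ⟩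
        h + (k + (length bottom ∸ suc j))  ≡⟨ cong (λ b → h + (k + (b ∸ suc j))) length-bottom ⟩
        h + (k + (h ∸ suc j))              ≡⟨ cong (h +_) (+-∸-assoc k j<h) ⟨
        h + (k + h ∸ suc j)                ≡⟨ +-∸-assoc h (≤-trans j<h (m≤n+m h k)) ⟨
        h + (k + h) ∸ suc j                ∎

w≡half+parity+half : ∀ w → w ≡ w / 2 + (w % 2 + w / 2)
w≡half+parity+half w =
  trans (m≡m%n+[m/n]*n w 2) (solve 2 (λ k h → k :+ h :* con 2 := h :+ (k :+ h)) refl (w % 2) (w / 2))

parity≤1 : ∀ w → w % 2 ≤ 1
parity≤1 w = s≤s⁻¹ (m%n<n w 2)

module ParametersOf {w} (m : Digits w) =
  Halves (w / 2) (w % 2) (descDigits m) (trans (length-descDigits m) (w≡half+parity+half w))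

parameters : ∀ {w} → Digits w → List ℕ
parameters m = ParametersOf.outerDifferences m

length-parameters : ∀ {w} (m : Digits w) → length (parameters m) ≡ w / 2
length-parameters m = ParametersOf.length-outerDifferences m

at-parameters : ∀ {w} (m : Digits w) j → j < w / 2 → at (parameters m) j ≡ α m (suc j)
at-parameters {w} m j j<h =
  trans (ParametersOf.at-outerDifferences m j j<h)
        (cong (λ n → at (descDigits m) j ∸ at (descDigits m) (n ∸ suc j)) (sym (w≡half+parity+half w)))

parameters-bounded : ∀ {w} (m : Digits w) → All (_< 10) (parameters m)
parameters-bounded {w} m = zipWith-∸-bounded _ _ (All.take⁺ (w / 2) (descDigits-bounded m))

parameters-positive : ∀ {w} (m : Digits w) →
  (∀ i → 1 ≤ i → i ≤ w / 2 → 1 ≤ α m i) → All (1 ≤_) (parameters m)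
parameters-positive m α≥1 = All-at (parameters m) λ j j< →
  let j<h = subst (j <_) (length-parameters m) j< in
  subst (1 ≤_) (sym (at-parameters m j j<h)) (α≥1 (suc j) (s≤s z≤n) j<h)

Od∸Ou≡value-kaprekarDigits : ∀ {w} (m : Digits w) → 1 ≤ w / 2 → All (1 ≤_) (parameters m) →
  Od m ∸ Ou m ≡ value (kaprekarDigits (parameters m) (w % 2))
Od∸Ou≡value-kaprekarDigits {w} m 1≤h a≥1 = begin
    value ds ∸ value (ascDigits m)
      ≡⟨ cong (λ l → value ds ∸ value l) (reverse-involutive (ascDigits m)) ⟨
    value ds ∸ value (reverse ds)
      ≡⟨ cong (λ l → value l ∸ value (reverse l)) split ⟩
    value ds′ ∸ value (reverse ds′)
      ≡⟨ cong (_∸ value (reverse ds′))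
           (value≡value-reverse+kaprekarDigits top middle bottom middle-palindrome 1≤|top| bottom<top top<10) ⟩
    value (reverse ds′) + value (kaprekarDigits a (length middle)) ∸ value (reverse ds′)
      ≡⟨ m+n∸m≡n (value (reverse ds′)) _ ⟩
    value (kaprekarDigits a (length middle))
      ≡⟨ cong (λ l → value (kaprekarDigits a l)) length-middle ⟩
    value (kaprekarDigits a (w % 2)) ∎
  where
    open ≡-Reasoning
    open ParametersOf m
    ds = descDigits m
    ds′ = top ++ middle ++ bottom
    a = parameters m
    top<10 : All (_< 10) top
    top<10 = All.take⁺ (w / 2) (descDigits-bounded m)
    1≤|top| : 1 ≤ length top
    1≤|top| = subst (1 ≤_) (sym length-top) 1≤h
    middle-palindrome : reverse middle ≡ middle
    middle-palindrome = reverse-short middle (subst (_≤ 1) (sym length-middle) (parity≤1 w))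
    bottom<top : Pointwise _<_ (reverse bottom) top
    bottom<top = positive-differences⁻¹ top (reverse bottom) |top|≡|reverse-bottom| a≥1

digitList-K : ∀ {w} (m : Digits w) → 1 ≤ w / 2 → All (1 ≤_) (parameters m) →
  digitList (K m) ≡ kaprekarDigits (parameters m) (w % 2)
digitList-K {w} m 1≤h a≥1 = begin
    digitList (toDigits w (Od m ∸ Ou m))
      ≡⟨ cong (λ n → digitList (toDigits w n)) (Od∸Ou≡value-kaprekarDigits m 1≤h a≥1) ⟩
    digitList (toDigits w (value kd))
      ≡⟨ cong (λ l → digitList (toDigits l (value kd))) |kd|≡w ⟨
    digitList (toDigits (length kd) (value kd))
      ≡⟨ digitList-toDigits kd (kaprekarDigits-bounded (w % 2) a≥1 (parameters-bounded m)) ⟩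
    kd ∎
  where
    open ≡-Reasoning
    kd = kaprekarDigits (parameters m) (w % 2)
    |kd|≡w : length kd ≡ w
    |kd|≡w = trans (length-kaprekarDigits (parameters m) (w % 2))
                   (trans (cong (λ l → l + (w % 2 + l)) (length-parameters m)) (sym (w≡half+parity+half w)))

decLast-++ : ∀ xs y z zs → decLast (xs ++ y ∷ z ∷ zs) ≡ xs ++ y ∷ decLast (z ∷ zs)
decLast-++ [] y z zs = refl
decLast-++ (x ∷ []) y z zs = refl
decLast-++ (x ∷ x′ ∷ xs) y z zs = cong (x ∷_) (decLast-++ (x′ ∷ xs) y z zs)

-- Away from both ends, an entry x of a shows up in kaprekarDigits a k as x and as 9 − x.
kaprekarDigits-↭-extract : ∀ p P x q Q k →
  kaprekarDigits ((p ∷ P) ++ x ∷ q ∷ Q) k ↭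
  x ∷ (9 ∸ x) ∷ (((p ∷ P) ++ decLast (q ∷ Q)) ++ replicate k 9) ++ suc (9 ∸ p) ∷ complement P ++ complement (q ∷ Q)
kaprekarDigits-↭-extract p P x q Q k = begin
    decLast a ++ replicate k 9 ++ reverse (incHead (complement a))
      ↭⟨ ++⁺ˡ (decLast a) (++⁺ˡ (replicate k 9) (↭-reverse (incHead (complement a)))) ⟩
    decLast a ++ replicate k 9 ++ incHead (complement a)
      ≡⟨ cong₂ (λ l l′ → l ++ replicate k 9 ++ l′)
           (decLast-++ (p ∷ P) x q Q) (cong (suc (9 ∸ p) ∷_) (map-++ (9 ∸_) P (x ∷ q ∷ Q))) ⟩
    ((p ∷ P) ++ x ∷ dQ) ++ replicate k 9 ++ (suc (9 ∸ p) ∷ cP) ++ (9 ∸ x) ∷ cQ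
      ↭⟨ ++⁺ (shift x (p ∷ P) dQ) (++⁺ˡ (replicate k 9) (shift (9 ∸ x) (suc (9 ∸ p) ∷ cP) cQ)) ⟩
    x ∷ ((p ∷ P) ++ dQ) ++ replicate k 9 ++ (9 ∸ x) ∷ rest
      ≡⟨ cong (x ∷_) (++-assoc ((p ∷ P) ++ dQ) (replicate k 9) ((9 ∸ x) ∷ rest)) ⟨
    x ∷ (((p ∷ P) ++ dQ) ++ replicate k 9) ++ (9 ∸ x) ∷ rest
      ↭⟨ ↭-prep x (shift (9 ∸ x) (((p ∷ P) ++ dQ) ++ replicate k 9) rest) ⟩
    x ∷ (9 ∸ x) ∷ (((p ∷ P) ++ dQ) ++ replicate k 9) ++ rest ∎
  where
    open PermutationReasoning
    a = (p ∷ P) ++ x ∷ q ∷ Q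
    dQ = decLast (q ∷ Q)
    cP = complement P
    cQ = complement (q ∷ Q)
    rest = suc (9 ∸ p) ∷ cP ++ cQ

kaprekarDigits-complementAt : ∀ P x Q k → 1 ≤ length P → 1 ≤ length Q → x ≤ 9 →
  kaprekarDigits (P ++ x ∷ Q) k ↭ kaprekarDigits (P ++ (9 ∸ x) ∷ Q) k
kaprekarDigits-complementAt (p ∷ P) x (q ∷ Q) k _ _ x≤9 = begin
    kaprekarDigits ((p ∷ P) ++ x ∷ q ∷ Q) k
      ↭⟨ kaprekarDigits-↭-extract p P x q Q k ⟩
    x ∷ (9 ∸ x) ∷ rest
      ↭⟨ ↭-swap x (9 ∸ x) ↭-refl ⟩
    (9 ∸ x) ∷ x ∷ rest
      ≡⟨ cong (λ y → (9 ∸ x) ∷ y ∷ rest) (m∸[m∸n]≡n x≤9) ⟨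
    (9 ∸ x) ∷ (9 ∸ (9 ∸ x)) ∷ rest
      ↭⟨ kaprekarDigits-↭-extract p P (9 ∸ x) q Q k ⟨
    kaprekarDigits ((p ∷ P) ++ (9 ∸ x) ∷ q ∷ Q) k ∎
  where
    open PermutationReasoning
    rest = (((p ∷ P) ++ decLast (q ∷ Q)) ++ replicate k 9) ++ suc (9 ∸ p) ∷ complement P ++ complement (q ∷ Q)

K²-complementAt-invariant : ∀ {w} (m n : Digits w) p → 1 ≤ p → suc p < w / 2 →
  All (1 ≤_) (parameters m) → All (1 ≤_) (parameters n) →
  (∀ j → j < w / 2 → j ≢ p → at (parameters n) j ≡ at (parameters m) j) →
  at (parameters n) p ≡ 9 ∸ at (parameters m) p →
  K² m ≡ K² n
K²-complementAt-invariant {w} m n p 1≤p p+1<h m≥1 n≥1 agree complemented =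
  K-cong-↭ (subst₂ _↭_ (sym (digitList-K m 1≤h m≥1)) (sym (digitList-K n 1≤h n≥1))
    (subst₂ (λ l l′ → kaprekarDigits l (w % 2) ↭ kaprekarDigits l′ (w % 2)) (sym am-split) (sym an-split)
      (kaprekarDigits-complementAt prefix x suffix (w % 2) 1≤|prefix| 1≤|suffix| x≤9)))
  where
    am = parameters m
    an = parameters n
    x = at am p
    prefix = take p am
    suffix = drop (suc p) am
    1≤h : 1 ≤ w / 2
    1≤h = ≤-trans (s≤s z≤n) p+1<h
    p+1<|am| : suc p < length am
    p+1<|am| = subst (suc p <_) (sym (length-parameters m)) p+1<h
    p<|am| : p < length am
    p<|am| = ≤-trans (n≤1+n (suc p)) p+1<|am|
    x≤9 : x ≤ 9
    x≤9 = s≤s⁻¹ (All-at⁻ (parameters-bounded m) p p<|am|)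
    1≤|prefix| : 1 ≤ length prefix
    1≤|prefix| = subst (1 ≤_) (sym (trans (length-take p am) (m≤n⇒m⊓n≡m (<⇒≤ p<|am|)))) 1≤p
    1≤|suffix| : 1 ≤ length suffix
    1≤|suffix| = subst (1 ≤_) (sym (length-drop (suc p) am)) (m<n⇒0<n∸m p+1<|am|)
    am-split : am ≡ prefix ++ x ∷ suffix
    am-split = ≡-replaceAt am am p refl p<|am| (λ _ _ _ → refl)
    an-split : an ≡ prefix ++ (9 ∸ x) ∷ suffix
    an-split = trans
      (≡-replaceAt am an p (trans (length-parameters m) (sym (length-parameters n))) p<|am|
        (λ j j< → agree j (subst (j <_) (length-parameters m) j<)))
      (cong (λ y → prefix ++ y ∷ suffix) complemented)

≤∸1⇒< : ∀ {m n} → 1 ≤ m → m ≤ n ∸ 1 → m < n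
≤∸1⇒< {n = suc n} _ m≤n = s≤s m≤n
≤∸1⇒< {suc m} {zero} _ ()

mainTheorem11 : (w : ℕ) → 6 ≤ w → (s : ℕ) → 2 ≤ s → s ≤ w / 2 ∸ 1 →
    (m n : Digits w) → InA m → InA n →
    (∀ i → 1 ≤ i → i ≤ w / 2 → 1 ≤ α m i) →
    9 ≤ α m (s ∸ 1) + α m s →
    α m s + α m (s + 1) ≤ 9 →
    (∀ i → 1 ≤ i → i ≤ w / 2 → i ≢ s → α n i ≡ α m i) →
    α n s ≡ 9 ∸ α m s →
    K² m ≡ K² n
mainTheorem11 w _ s@(suc p@(suc _)) (s≤s 1≤p) s≤h-1 m n _ _ αm≥1 _ αs+αs+1≤9 αn≡αm αn-s≡9∸αm-s =
  K²-complementAt-invariant m n p 1≤p s<h (parameters-positive m αm≥1) (parameters-positive n αn≥1)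
    agree complemented
  where
    s<h : s < w / 2
    s<h = ≤∸1⇒< (s≤s z≤n) s≤h-1
    p<h : p < w / 2
    p<h = <⇒≤ s<h
    αm-s+1≥1 : 1 ≤ α m (s + 1)
    αm-s+1≥1 = αm≥1 (s + 1) (s≤s z≤n) (subst (_≤ w / 2) (+-comm 1 s) s<h)
    αm-s<9 : α m s < 9
    αm-s<9 = ≤-trans (subst (_≤ α m s + α m (s + 1)) (+-comm (α m s) 1) (+-monoʳ-≤ (α m s) αm-s+1≥1))
               αs+αs+1≤9
    αn≥1 : ∀ i → 1 ≤ i → i ≤ w / 2 → 1 ≤ α n i
    αn≥1 i 1≤i i≤h with i ≟ s
    ... | yes refl = subst (1 ≤_) (sym αn-s≡9∸αm-s) (m<n⇒0<n∸m αm-s<9)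
    ... | no i≢s = subst (1 ≤_) (sym (αn≡αm i 1≤i i≤h i≢s)) (αm≥1 i 1≤i i≤h)
    agree : ∀ j → j < w / 2 → j ≢ p → at (parameters n) j ≡ at (parameters m) j
    agree j j<h j≢p = begin
      at (parameters n) j  ≡⟨ at-parameters n j j<h ⟩
      α n (suc j)          ≡⟨ αn≡αm (suc j) (s≤s z≤n) j<h (j≢p ∘ suc-injective) ⟩
      α m (suc j)          ≡⟨ at-parameters m j j<h ⟨
      at (parameters m) j  ∎
      where open ≡-Reasoning
    complemented : at (parameters n) p ≡ 9 ∸ at (parameters m) p
    complemented = begin
      at (parameters n) p      ≡⟨ at-parameters n p p<h ⟩
      α n s                    ≡⟨ αn-s≡9∸αm-s ⟩
      9 ∸ α m s                ≡⟨ cong (9 ∸_) (at-parameters m p p<h) ⟨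
      9 ∸ at (parameters m) p  ∎
      where open ≡-Reasoning
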